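{- Let $n$ and $p$ be positive integers with $n>2p$, and let $k=n-2p$. For an integer $z$ with $0\le z\le\frac{n-k}{2}$, let $b(z)$ denote the remainder of $\frac{n-k}{2}-z$ upon division by $k+z$, and define \[ D(z)= -z^2+(2n+1)z+\frac{(n+k)^2}{k+z}-3n-k+4\Big(b(z)-\frac{b(z)^2}{k+z}\Big). \] Let $z^\dagger=\frac{1}{4}\big(\sqrt{8n+8k+1}-4k+1\big)$. If $z^\dagger\le 0$ and $k\le\sqrt{n}$ (equivalently, $k^2\le n\le 2k^2-2k$), then the minimum of $D(z)$ over the integers $z\in[0,\frac{n-k}{2}]$ is attained at $z=0$. -}

module Defs where

open import Data.Nat as ℕ using (ℕ; zero; suc; _∸_)
open import Data.Nat.DivMod using (_/_; _%_)
open import Data.Integer as ℤ using (ℤ; +_)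
open import Data.Rational as ℚ using (ℚ)

ℕtoℚ : ℕ → ℚ
ℕtoℚ m = (+ m) ℚ./ 1

-- rational quotient a / d  (only ever used with d ≥ 1; value 0 for d = 0 is a dummy)
divℚ : ℕ → ℕ → ℚ
divℚ a zero    = ℚ.0ℚ
divℚ a (suc d) = (+ a) ℚ./ suc d

-- remainder of a upon division by d (only used with d ≥ 1; dummy for d = 0)
modℕ : ℕ → ℕ → ℕ
modℕ a zero    = a
modℕ a (suc d) = a % suc d

half : ℕ → ℕ → ℕ
half n k = (n ∸ k) / 2

b : ℕ → ℕ → ℕ → ℕ
b n k z = modℕ (half n k ∸ z) (k ℕ.+ z)

D : ℕ → ℕ → ℕ → ℚ
D n k z =
  ((((ℚ.- (ℕtoℚ (z ℕ.* z)) ℚ.+ ℕtoℚ ((2 ℕ.* n ℕ.+ 1) ℕ.* z))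
      ℚ.+ divℚ ((n ℕ.+ k) ℕ.* (n ℕ.+ k)) (k ℕ.+ z))
      ℚ.- ℕtoℚ (3 ℕ.* n))
      ℚ.- ℕtoℚ k)
  ℚ.+ ℕtoℚ 4 ℚ.* (ℕtoℚ bz ℚ.- divℚ (bz ℕ.* bz) (k ℕ.+ z))
  where bz = b n k z

-- D n k z = smoothPart n k z + 4 · remainderPart (b n k z) (k + z), where
-- remainderPart b m = b - b²/m = b (m - b)/m. Since b n k z is a remainder modulo k + z,
-- 0 ≤ 4 · remainderPart b m ≤ m, the upper bound being (m - 2b)² ≥ 0. So D(0) is at most
-- smoothPart(0) + k and D(z) is at least smoothPart(z), and it suffices to show
-- smoothPart(0) + k ≤ smoothPart(z) for 1 ≤ z ≤ (n - k)/2. Multiplied by k (k + z) this is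
-- T(z) ≥ 0 for the cubic T(z) = k z (k + z)(2n + 1) - z (n + k)² - k (k + z)(k + z²), and
--   T(z) = T(1) + (z - 1) Q + (z - 1)² k (2n - k - z - 1),
--   T(1) = x (y + 3k) + y k (k + 1),   Q = n y + 4 k x + k (k - 1)(4k + 1),
-- where x = n - k² and y = 2k² - 2k - n are the (nonnegative) slacks of k² ≤ n ≤ 2k² - 2k.

module Submission where

open import Defs

module D-minimum where

  open import Data.Nat as ℕ using (ℕ; zero; suc; z≤n; s≤s)
  import Data.Nat.Properties as ℕ
  open import Data.Nat.DivMod using (m%n<n)
  import Data.Integer as ℤ
  import Data.Integer.Properties as ℤ
  import Data.Integer.Tactic.RingSolver as ℤ
  open import Data.Rational
    using (ℚ; 0ℚ; _+_; _*_; _-_; -_; _≤_; Positive; toℚᵘ; nonNegative; nonPositive)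
  open import Data.Rational.Properties
  import Data.Rational.Unnormalised as ℚᵘ
  import Data.Rational.Unnormalised.Properties as ℚᵘ
  open import Data.Sum using (inj₁; inj₂)
  open import Level using (0ℓ)
  open import Relation.Binary.PropositionalEquality
  open import Relation.Nullary.Decidable.Core using (dec⇒maybe)
  open import Tactic.RingSolver using (solve-∀)
  open import Tactic.RingSolver.Core.AlmostCommutativeRing
    using (AlmostCommutativeRing; fromCommutativeRing)

  -- The solver needs a genuine zero test to cancel coefficients.
  ℚ-ring : AlmostCommutativeRing 0ℓ 0ℓ
  ℚ-ring = fromCommutativeRing +-*-commutativeRing (λ p → dec⇒maybe (0ℚ ≟ p))

  toℚᵘ-ℕtoℚ : ∀ m → toℚᵘ (ℕtoℚ m) ℚᵘ.≃ ℚᵘ.mkℚᵘ (ℤ.+ m) 0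
  toℚᵘ-ℕtoℚ m = toℚᵘ-fromℚᵘ (ℚᵘ.mkℚᵘ (ℤ.+ m) 0)

  ℕtoℚ-homo-+ : ∀ m n → ℕtoℚ (m ℕ.+ n) ≡ ℕtoℚ m + ℕtoℚ n
  ℕtoℚ-homo-+ m n = toℚᵘ-injective (begin
    toℚᵘ (ℕtoℚ (m ℕ.+ n))                      ≈⟨ toℚᵘ-ℕtoℚ (m ℕ.+ n) ⟩
    ℚᵘ.mkℚᵘ (ℤ.+ (m ℕ.+ n)) 0                   ≈⟨ ℚᵘ.*≡* (cong (ℤ._* ℤ.+ 1) (ℤ.pos-+ m n)) ⟩
    ℚᵘ.mkℚᵘ (ℤ.+ m ℤ.+ ℤ.+ n) 0                 ≈⟨ ℚᵘ.*≡* (sum (ℤ.+ m) (ℤ.+ n)) ⟩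
    ℚᵘ.mkℚᵘ (ℤ.+ m) 0 ℚᵘ.+ ℚᵘ.mkℚᵘ (ℤ.+ n) 0     ≈⟨ ℚᵘ.+-cong (toℚᵘ-ℕtoℚ m) (toℚᵘ-ℕtoℚ n) ⟨
    toℚᵘ (ℕtoℚ m) ℚᵘ.+ toℚᵘ (ℕtoℚ n)            ≈⟨ toℚᵘ-homo-+ (ℕtoℚ m) (ℕtoℚ n) ⟨
    toℚᵘ (ℕtoℚ m + ℕtoℚ n)                      ∎)
    where
    open ℚᵘ.≃-Reasoning
    sum : ∀ x y → (x ℤ.+ y) ℤ.* ℤ.+ 1 ≡ (x ℤ.* ℤ.+ 1 ℤ.+ y ℤ.* ℤ.+ 1) ℤ.* ℤ.+ 1
    sum = solve-∀ ℤ.ring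

  ℕtoℚ-homo-* : ∀ m n → ℕtoℚ (m ℕ.* n) ≡ ℕtoℚ m * ℕtoℚ n
  ℕtoℚ-homo-* m n = toℚᵘ-injective (begin
    toℚᵘ (ℕtoℚ (m ℕ.* n))                      ≈⟨ toℚᵘ-ℕtoℚ (m ℕ.* n) ⟩
    ℚᵘ.mkℚᵘ (ℤ.+ (m ℕ.* n)) 0                   ≈⟨ ℚᵘ.*≡* (cong (ℤ._* ℤ.+ 1) (ℤ.pos-* m n)) ⟩
    ℚᵘ.mkℚᵘ (ℤ.+ m) 0 ℚᵘ.* ℚᵘ.mkℚᵘ (ℤ.+ n) 0     ≈⟨ ℚᵘ.*-cong (toℚᵘ-ℕtoℚ m) (toℚᵘ-ℕtoℚ n) ⟨
    toℚᵘ (ℕtoℚ m) ℚᵘ.* toℚᵘ (ℕtoℚ n)            ≈⟨ toℚᵘ-homo-* (ℕtoℚ m) (ℕtoℚ n) ⟨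
    toℚᵘ (ℕtoℚ m * ℕtoℚ n)                      ∎)
    where open ℚᵘ.≃-Reasoning

  ℕtoℚ-mono-≤ : ∀ {m n} → m ℕ.≤ n → ℕtoℚ m ≤ ℕtoℚ n
  ℕtoℚ-mono-≤ {m} {n} m≤n = toℚᵘ-cancel-≤
    (ℚᵘ.≤-respˡ-≃ (ℚᵘ.≃-sym (toℚᵘ-ℕtoℚ m)) (ℚᵘ.≤-respʳ-≃ (ℚᵘ.≃-sym (toℚᵘ-ℕtoℚ n))
      (ℚᵘ.*≤* (ℤ.*-monoʳ-≤-nonNeg (ℤ.+ 1) (ℤ.+≤+ m≤n)))))

  ℕtoℚ-pos : ∀ d → Positive (ℕtoℚ (suc d))
  ℕtoℚ-pos d = normalize-pos (suc d) 1

  0≤ℕtoℚ : ∀ m → 0ℚ ≤ ℕtoℚ m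
  0≤ℕtoℚ m = nonNegative⁻¹ (ℕtoℚ m) {{normalize-nonNeg m 1}}

  divℚ-*-cancel : ∀ a d → divℚ a (suc d) * ℕtoℚ (suc d) ≡ ℕtoℚ a
  divℚ-*-cancel a d = toℚᵘ-injective (begin
    toℚᵘ (divℚ a (suc d) * ℕtoℚ (suc d))             ≈⟨ toℚᵘ-homo-* (divℚ a (suc d)) (ℕtoℚ (suc d)) ⟩
    toℚᵘ (divℚ a (suc d)) ℚᵘ.* toℚᵘ (ℕtoℚ (suc d))   ≈⟨ ℚᵘ.*-cong (toℚᵘ-fromℚᵘ (ℚᵘ.mkℚᵘ (ℤ.+ a) d))
                                                                  (toℚᵘ-ℕtoℚ (suc d)) ⟩
    ℚᵘ.mkℚᵘ (ℤ.+ a) d ℚᵘ.* ℚᵘ.mkℚᵘ (ℤ.+ suc d) 0       ≈⟨ ℚᵘ.*≡* (cancel (ℤ.+ a) (ℤ.+ suc d)) ⟩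
    ℚᵘ.mkℚᵘ (ℤ.+ a) 0                                 ≈⟨ toℚᵘ-ℕtoℚ a ⟨
    toℚᵘ (ℕtoℚ a)                                     ∎)
    where
    open ℚᵘ.≃-Reasoning
    cancel : ∀ x y → (x ℤ.* y) ℤ.* ℤ.+ 1 ≡ x ℤ.* (y ℤ.* ℤ.+ 1)
    cancel = solve-∀ ℤ.ring

  0≤+ : ∀ {p q} → 0ℚ ≤ p → 0ℚ ≤ q → 0ℚ ≤ p + q
  0≤+ = +-mono-≤

  0≤* : ∀ {p q} → 0ℚ ≤ p → 0ℚ ≤ q → 0ℚ ≤ p * q
  0≤* {p} {q} 0≤p 0≤q =
    nonNegative⁻¹ (p * q) {{nonNeg*nonNeg⇒nonNeg p {{nonNegative 0≤p}} q {{nonNegative 0≤q}}}}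

  0≤p*p : ∀ p → 0ℚ ≤ p * p
  0≤p*p p with ≤-total 0ℚ p
  ... | inj₁ 0≤p = 0≤* 0≤p 0≤p
  ... | inj₂ p≤0 =
    nonNegative⁻¹ (p * p) {{nonPos*nonPos⇒nonPos p {{nonPositive p≤0}} p {{nonPositive p≤0}}}}

  p≤q⇒0≤q-p : ∀ {p q} → p ≤ q → 0ℚ ≤ q - p
  p≤q⇒0≤q-p {p} {q} p≤q = subst (_≤ q - p) (+-inverseʳ p) (+-monoˡ-≤ (- p) p≤q)

  0≤q-p⇒p≤q : ∀ {p q} → 0ℚ ≤ q - p → p ≤ q
  0≤q-p⇒p≤q {p} {q} 0≤q-p = subst₂ _≤_ (+-identityʳ p) (p+[q-p]≡q p q) (+-monoʳ-≤ p 0≤q-p)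
    where
    p+[q-p]≡q : ∀ p q → p + (q - p) ≡ q
    p+[q-p]≡q = solve-∀ ℚ-ring

  p≤p+q : ∀ {p q} → 0ℚ ≤ q → p ≤ p + q
  p≤p+q {p} {q} 0≤q = subst (_≤ p + q) (+-identityʳ p) (+-monoʳ-≤ p 0≤q)

  0≤p*m⇒0≤p : ∀ {p} m .{{_ : Positive m}} → 0ℚ ≤ p * m → 0ℚ ≤ p
  0≤p*m⇒0≤p {p} m 0≤pm = *-cancelʳ-≤-pos m (subst (_≤ p * m) (sym (*-zeroˡ m)) 0≤pm)

  remainderPart : ℕ → ℕ → ℚ
  remainderPart b m = ℕtoℚ b - divℚ (b ℕ.* b) m

  remainderPart-cleared : ∀ b d →
    remainderPart b (suc d) * ℕtoℚ (suc d) ≡ ℕtoℚ b * ℕtoℚ (suc d) - ℕtoℚ b * ℕtoℚ b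
  remainderPart-cleared b d = begin
    (B - divℚ (b ℕ.* b) (suc d)) * M          ≡⟨ distrib B (divℚ (b ℕ.* b) (suc d)) M ⟩
    B * M - divℚ (b ℕ.* b) (suc d) * M        ≡⟨ cong (_-_ (B * M)) b²/m*m≡b² ⟩
    B * M - B * B                             ∎
    where
    open ≡-Reasoning
    B M : ℚ
    B = ℕtoℚ b
    M = ℕtoℚ (suc d)
    distrib : ∀ u v w → (u - v) * w ≡ u * w - v * w
    distrib = solve-∀ ℚ-ring
    b²/m*m≡b² : divℚ (b ℕ.* b) (suc d) * M ≡ B * B
    b²/m*m≡b² = trans (divℚ-*-cancel (b ℕ.* b) d) (ℕtoℚ-homo-* b b)

  remainderPart-nonNeg : ∀ {b d} → b ℕ.≤ suc d → 0ℚ ≤ remainderPart b (suc d)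
  remainderPart-nonNeg {b} {d} b≤m = 0≤p*m⇒0≤p (ℕtoℚ (suc d)) {{ℕtoℚ-pos d}}
    (subst (0ℚ ≤_) (sym (remainderPart-cleared b d))
      (p≤q⇒0≤q-p (*-monoˡ-≤-nonNeg (ℕtoℚ b) {{normalize-nonNeg b 1}} (ℕtoℚ-mono-≤ b≤m))))

  4*remainderPart≤m : ∀ b d → ℕtoℚ 4 * remainderPart b (suc d) ≤ ℕtoℚ (suc d)
  4*remainderPart≤m b d = 0≤q-p⇒p≤q (0≤p*m⇒0≤p M {{ℕtoℚ-pos d}}
    (subst (0ℚ ≤_) (sym cleared) (0≤p*p (M - ℕtoℚ 2 * B))))
    where
    open ≡-Reasoning
    B M R : ℚ
    B = ℕtoℚ b
    M = ℕtoℚ (suc d)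
    R = remainderPart b (suc d)
    expand : ∀ m r → (m - ℕtoℚ 4 * r) * m ≡ m * m - ℕtoℚ 4 * (r * m)
    expand = solve-∀ ℚ-ring
    square : ∀ m b → m * m - ℕtoℚ 4 * (b * m - b * b) ≡ (m - ℕtoℚ 2 * b) * (m - ℕtoℚ 2 * b)
    square = solve-∀ ℚ-ring
    cleared : (M - ℕtoℚ 4 * R) * M ≡ (M - ℕtoℚ 2 * B) * (M - ℕtoℚ 2 * B)
    cleared = begin
      (M - ℕtoℚ 4 * R) * M                  ≡⟨ expand M R ⟩
      M * M - ℕtoℚ 4 * (R * M)              ≡⟨ cong (λ t → M * M - ℕtoℚ 4 * t) (remainderPart-cleared b d) ⟩
      M * M - ℕtoℚ 4 * (B * M - B * B)      ≡⟨ square M B ⟩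
      (M - ℕtoℚ 2 * B) * (M - ℕtoℚ 2 * B)   ∎

  smoothPart : ℕ → ℕ → ℕ → ℚ
  smoothPart n k z =
    (((- ℕtoℚ (z ℕ.* z) + ℕtoℚ ((2 ℕ.* n ℕ.+ 1) ℕ.* z)) + divℚ ((n ℕ.+ k) ℕ.* (n ℕ.+ k)) (k ℕ.+ z))
      - ℕtoℚ (3 ℕ.* n)) - ℕtoℚ k

  smoothPart-cleared : ∀ n j z →
    let N = ℕtoℚ n
        K = ℕtoℚ (suc j)
        Z = ℕtoℚ z
    in smoothPart n (suc j) z * (K + Z)
       ≡ (N + K) * (N + K) + ((ℕtoℚ 2 * N + ℕtoℚ 1) * Z - Z * Z - ℕtoℚ 3 * N - K) * (K + Z)
  smoothPart-cleared n j z = begin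
    smoothPart n k z * (K + Z)            ≡⟨ cong (smoothPart n k z *_) (ℕtoℚ-homo-+ k z) ⟨
    smoothPart n k z * M                  ≡⟨ separate A B (divℚ S (k ℕ.+ z)) C K M ⟩
    divℚ S (k ℕ.+ z) * M + P * M          ≡⟨ cong₂ _+_ (divℚ-*-cancel S (j ℕ.+ z)) (cong (_* M) P≡) ⟩
    ℕtoℚ S + P′ * M                       ≡⟨ cong₂ (λ u v → u + P′ * v) S≡ (ℕtoℚ-homo-+ k z) ⟩
    (N + K) * (N + K) + P′ * (K + Z)      ∎
    where
    open ≡-Reasoning
    k S : ℕ
    k = suc j
    S = (n ℕ.+ k) ℕ.* (n ℕ.+ k)
    N K Z M A B C P P′ : ℚ
    N = ℕtoℚ n
    K = ℕtoℚ k
    Z = ℕtoℚ z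
    M = ℕtoℚ (k ℕ.+ z)
    A = ℕtoℚ (z ℕ.* z)
    B = ℕtoℚ ((2 ℕ.* n ℕ.+ 1) ℕ.* z)
    C = ℕtoℚ (3 ℕ.* n)
    P = B - A - C - K
    P′ = (ℕtoℚ 2 * N + ℕtoℚ 1) * Z - Z * Z - ℕtoℚ 3 * N - K
    separate : ∀ a b x c k m → ((((- a + b) + x) - c) - k) * m ≡ x * m + (b - a - c - k) * m
    separate = solve-∀ ℚ-ring
    B≡ : B ≡ (ℕtoℚ 2 * N + ℕtoℚ 1) * Z
    B≡ = trans (ℕtoℚ-homo-* (2 ℕ.* n ℕ.+ 1) z)
      (cong (_* Z) (trans (ℕtoℚ-homo-+ (2 ℕ.* n) 1) (cong (_+ ℕtoℚ 1) (ℕtoℚ-homo-* 2 n))))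
    P≡ : P ≡ P′
    P≡ = trans (cong (λ c → B - A - c - K) (ℕtoℚ-homo-* 3 n))
      (cong₂ (λ b a → b - a - ℕtoℚ 3 * N - K) B≡ (ℕtoℚ-homo-* z z))
    S≡ : ℕtoℚ S ≡ (N + K) * (N + K)
    S≡ = trans (ℕtoℚ-homo-* (n ℕ.+ k) (n ℕ.+ k)) (cong₂ _*_ (ℕtoℚ-homo-+ n k) (ℕtoℚ-homo-+ n k))

  cleared-gap≡certificate : ∀ N K Z →
    ((N + K) * (N + K) + ((ℕtoℚ 2 * N + ℕtoℚ 1) * Z - Z * Z - ℕtoℚ 3 * N - K) * (K + Z)) * K
    - ((N + K) * (N + K)
       + ((ℕtoℚ 2 * N + ℕtoℚ 1) * ℕtoℚ 0 - ℕtoℚ 0 * ℕtoℚ 0 - ℕtoℚ 3 * N - K) * (K + ℕtoℚ 0)) * (K + Z)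
    - K * K * (K + Z)
    ≡ (N - K * K) * ((ℕtoℚ 2 * (K * K) - (N + ℕtoℚ 2 * K)) + ℕtoℚ 3 * K)
      + (ℕtoℚ 2 * (K * K) - (N + ℕtoℚ 2 * K)) * (K * (K + ℕtoℚ 1))
      + (Z - ℕtoℚ 1) * (N * (ℕtoℚ 2 * (K * K) - (N + ℕtoℚ 2 * K)) + ℕtoℚ 4 * K * (N - K * K)
                        + K * (K - ℕtoℚ 1) * (ℕtoℚ 4 * K + ℕtoℚ 1))
      + (Z - ℕtoℚ 1) * (Z - ℕtoℚ 1) * K * ((N - (K + ℕtoℚ 2 * Z)) + N + (Z - ℕtoℚ 1))
  cleared-gap≡certificate = solve-∀ ℚ-ring

  smoothPart[0]+k≤smoothPart[z] : ∀ n j z → let k = suc j in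
    1 ℕ.≤ z → k ℕ.* k ℕ.≤ n → n ℕ.+ 2 ℕ.* k ℕ.≤ 2 ℕ.* (k ℕ.* k) → k ℕ.+ 2 ℕ.* z ℕ.≤ n →
    smoothPart n k 0 + ℕtoℚ k ≤ smoothPart n k z
  smoothPart[0]+k≤smoothPart[z] n j z 1≤z k²≤n n+2k≤2k² k+2z≤n =
    0≤q-p⇒p≤q (0≤p*m⇒0≤p (K * (K + Z)) {{k[k+z]-pos}} (subst (0ℚ ≤_) (sym cleared) certificate-nonNeg))
    where
    open ≡-Reasoning
    k : ℕ
    k = suc j
    N K Z : ℚ
    N = ℕtoℚ n
    K = ℕtoℚ k
    Z = ℕtoℚ z
    k[k+z]-pos : Positive (K * (K + Z))
    k[k+z]-pos = pos*pos⇒pos K {{ℕtoℚ-pos j}} (K + Z)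
      {{pos+nonNeg⇒pos K {{ℕtoℚ-pos j}} Z {{normalize-nonNeg z 1}}}}
    regroup : ∀ s t k z → (s - (t + k)) * (k * (k + z))
              ≡ (s * (k + z)) * k - (t * (k + ℕtoℚ 0)) * (k + z) - k * k * (k + z)
    regroup = solve-∀ ℚ-ring
    x y r a i certificate : ℚ
    x = N - K * K
    y = ℕtoℚ 2 * (K * K) - (N + ℕtoℚ 2 * K)
    r = N - (K + ℕtoℚ 2 * Z)
    a = Z - ℕtoℚ 1
    i = K - ℕtoℚ 1
    certificate = x * (y + ℕtoℚ 3 * K) + y * (K * (K + ℕtoℚ 1))
      + a * (N * y + ℕtoℚ 4 * K * x + K * i * (ℕtoℚ 4 * K + ℕtoℚ 1)) + a * a * K * (r + N + a)
    cleared : (smoothPart n k z - (smoothPart n k 0 + K)) * (K * (K + Z)) ≡ certificate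
    cleared = begin
      (smoothPart n k z - (smoothPart n k 0 + K)) * (K * (K + Z))
        ≡⟨ regroup (smoothPart n k z) (smoothPart n k 0) K Z ⟩
      (smoothPart n k z * (K + Z)) * K - (smoothPart n k 0 * (K + ℕtoℚ 0)) * (K + Z) - K * K * (K + Z)
        ≡⟨ cong₂ (λ u v → u * K - v * (K + Z) - K * K * (K + Z))
                 (smoothPart-cleared n j z) (smoothPart-cleared n j 0) ⟩
      _ ≡⟨ cleared-gap≡certificate N K Z ⟩
      certificate ∎
    0≤K : 0ℚ ≤ K
    0≤K = 0≤ℕtoℚ k
    0≤N : 0ℚ ≤ N
    0≤N = 0≤ℕtoℚ n
    0≤x : 0ℚ ≤ x
    0≤x = p≤q⇒0≤q-p (subst (_≤ N) (ℕtoℚ-homo-* k k) (ℕtoℚ-mono-≤ k²≤n))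
    0≤y : 0ℚ ≤ y
    0≤y = p≤q⇒0≤q-p (subst₂ _≤_
      (trans (ℕtoℚ-homo-+ n (2 ℕ.* k)) (cong (N +_) (ℕtoℚ-homo-* 2 k)))
      (trans (ℕtoℚ-homo-* 2 (k ℕ.* k)) (cong (ℕtoℚ 2 *_) (ℕtoℚ-homo-* k k)))
      (ℕtoℚ-mono-≤ n+2k≤2k²))
    0≤r : 0ℚ ≤ r
    0≤r = p≤q⇒0≤q-p (subst (_≤ N)
      (trans (ℕtoℚ-homo-+ k (2 ℕ.* z)) (cong (K +_) (ℕtoℚ-homo-* 2 z)))
      (ℕtoℚ-mono-≤ k+2z≤n))
    0≤a : 0ℚ ≤ a
    0≤a = p≤q⇒0≤q-p (ℕtoℚ-mono-≤ 1≤z)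
    0≤i : 0ℚ ≤ i
    0≤i = p≤q⇒0≤q-p (ℕtoℚ-mono-≤ {1} {k} (s≤s z≤n))
    certificate-nonNeg : 0ℚ ≤ certificate
    certificate-nonNeg = 0≤+ (0≤+ (0≤+
      (0≤* 0≤x (0≤+ 0≤y (0≤* (0≤ℕtoℚ 3) 0≤K)))
      (0≤* 0≤y (0≤* 0≤K (0≤+ 0≤K (0≤ℕtoℚ 1)))))
      (0≤* 0≤a (0≤+ (0≤+ (0≤* 0≤N 0≤y) (0≤* (0≤* (0≤ℕtoℚ 4) 0≤K) 0≤x))
                    (0≤* (0≤* 0≤K 0≤i) (0≤+ (0≤* (0≤ℕtoℚ 4) 0≤K) (0≤ℕtoℚ 1))))))
      (0≤* (0≤* (0≤* 0≤a 0≤a) 0≤K) (0≤+ (0≤+ 0≤r 0≤N) 0≤a))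

  b≤k+z : ∀ n j z → b n (suc j) z ℕ.≤ suc j ℕ.+ z
  b≤k+z n j z = ℕ.<⇒≤ (m%n<n (half n (suc j) ℕ.∸ z) (suc j ℕ.+ z))

  D[0]≤D[z] : ∀ n j z → let k = suc j in
    k ℕ.* k ℕ.≤ n → n ℕ.+ 2 ℕ.* k ℕ.≤ 2 ℕ.* (k ℕ.* k) → k ℕ.+ 2 ℕ.* z ℕ.≤ n → D n k 0 ≤ D n k z
  D[0]≤D[z] n j zero      _    _        _      = ≤-refl
  D[0]≤D[z] n j z@(suc _) k²≤n n+2k≤2k² k+2z≤n = begin
    D n k 0                                                          ≡⟨⟩
    smoothPart n k 0 + ℕtoℚ 4 * remainderPart (b n k 0) (k ℕ.+ 0)
      ≤⟨ +-monoʳ-≤ (smoothPart n k 0) (4*remainderPart≤m (b n k 0) (j ℕ.+ 0)) ⟩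
    smoothPart n k 0 + ℕtoℚ (k ℕ.+ 0)                                ≡⟨ cong (λ m → smoothPart n k 0 + ℕtoℚ m) (ℕ.+-identityʳ k) ⟩
    smoothPart n k 0 + ℕtoℚ k                                        ≤⟨ smoothPart[0]+k≤smoothPart[z] n j z (s≤s z≤n) k²≤n n+2k≤2k² k+2z≤n ⟩
    smoothPart n k z                                                 ≤⟨ p≤p+q (0≤* (0≤ℕtoℚ 4) (remainderPart-nonNeg (b≤k+z n j z))) ⟩
    smoothPart n k z + ℕtoℚ 4 * remainderPart (b n k z) (k ℕ.+ z)    ≡⟨⟩
    D n k z                                                          ∎
    where
    open ≤-Reasoning
    k : ℕ
    k = suc j

open D-minimum using (D[0]≤D[z])

open import Data.Nat using (ℕ; zero; suc; _+_; _*_; _∸_; _<_; _≤_)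
open import Data.Nat.Properties
  using (*-comm; m+n∸m≡n; m∸n+n≡m; <⇒≤; ≤-trans; m+n≤o⇒m≤o; +-monoʳ-≤; *-monoʳ-≤)
open import Data.Nat.DivMod using (_/_; m*n/n≡m)
open import Data.Rational as ℚ using ()
open import Relation.Binary.PropositionalEquality
open import Relation.Nullary using (contradiction)

half≡p : ∀ {n p} k → k + 2 * p ≡ n → half n k ≡ p
half≡p {n} {p} k k+2p≡n = begin
  (n ∸ k) / 2           ≡⟨ cong (λ m → (m ∸ k) / 2) k+2p≡n ⟨
  (k + 2 * p ∸ k) / 2   ≡⟨ cong (_/ 2) (m+n∸m≡n k (2 * p)) ⟩
  (2 * p) / 2           ≡⟨ cong (_/ 2) (*-comm 2 p) ⟩
  (p * 2) / 2           ≡⟨ m*n/n≡m p 2 ⟩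
  p                     ∎
  where open ≡-Reasoning

lemma4 : (n p : ℕ) → 0 < p → 2 * p < n →
    let k = n ∸ 2 * p in
    k * k ≤ n → n + 2 * k ≤ 2 * (k * k) →
    (z : ℕ) → z ≤ half n k → D n k 0 ℚ.≤ D n k z
lemma4 n p _ 2p<n = minimal-at-0 (n ∸ 2 * p) (m∸n+n≡m (<⇒≤ 2p<n))
  where
  minimal-at-0 : ∀ k → k + 2 * p ≡ n → k * k ≤ n → n + 2 * k ≤ 2 * (k * k) →
                 ∀ z → z ≤ half n k → D n k 0 ℚ.≤ D n k z
  minimal-at-0 zero    _      _    n+0≤0    _ _      = contradiction (≤-trans 2p<n (m+n≤o⇒m≤o n n+0≤0)) λ ()
  minimal-at-0 (suc j) k+2p≡n k²≤n n+2k≤2k² z z≤half =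
    D[0]≤D[z] n j z k²≤n n+2k≤2k² (subst (suc j + 2 * z ≤_) k+2p≡n
      (+-monoʳ-≤ (suc j) (*-monoʳ-≤ 2 {z} {p} (subst (z ≤_) (half≡p (suc j) k+2p≡n) z≤half))))
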